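{- Let $C$ be a simple object in a pre-Hilbert category. If $f,g:X\to C$ satisfy $\ker(f)\le\ker(g)$ as subobjects of $X$, then $g=s\circ f$ for some $s:C\to C$. Unless $f=0$, this $s$ is unique.
   Context: A $\dagger$-category is a category $\mathcal{H}$ with a functor $\dagger:\mathcal{H}^{\mathrm{op}}\to\mathcal{H}$ that is the identity on objects with $f^{\dagger\dagger}=f$. A morphism $m$ is a $\dagger$-mono if $m^\dagger m=\mathrm{id}$, a $\dagger$-epi if $mm^\dagger=\mathrm{id}$. A pre-Hilbert category is a $\dagger$-category such that: it has finite $\dagger$-biproducts (finite biproducts, including a zero object $0$, with $\pi^\dagger=\kappa$); it has finite $\dagger$-equalisers (equalisers that are $\dagger$-monos); every $\dagger$-mono is a kernel of some morphism; and it is symmetric $\dagger$-monoidal ($(f\otimes g)^\dagger=f^\dagger\otimes g^\dagger$, coherence isomorphisms $\dagger$-isos). Kernels are chosen to be $\dagger$-monos. Subobjects of $X$ (equivalence classes of monos into $X$) are ordered by $M\le N$ iff $m=nh$ for some $h$. An object $C$ is simple if its only subobjects are $0$ and $C$. -}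

module Defs where

open import Level using (Level; _⊔_) renaming (suc to lsuc)
open import Data.Product using (Σ; _×_; _,_)
open import Data.Sum using (_⊎_)
open import Relation.Binary.PropositionalEquality using (_≡_)

record PreHilbert (o ℓ : Level) : Set (lsuc (o ⊔ ℓ)) where
  infixr 9 _∘_
  infixr 10 _⊗₁_
  infixr 10 _⊗₀_
  field
    Obj : Set o
    Hom : Obj → Obj → Set ℓ
    id  : ∀ {A} → Hom A A
    _∘_ : ∀ {A B C} → Hom B C → Hom A B → Hom A C
    identityˡ : ∀ {A B} {f : Hom A B} → id ∘ f ≡ f
    identityʳ : ∀ {A B} {f : Hom A B} → f ∘ id ≡ f
    assoc : ∀ {A B C D} {f : Hom A B} {g : Hom B C} {h : Hom C D} →
            (h ∘ g) ∘ f ≡ h ∘ (g ∘ f)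
    _† : ∀ {A B} → Hom A B → Hom B A
    †-id : ∀ {A} → id {A} † ≡ id
    †-∘ : ∀ {A B C} {f : Hom A B} {g : Hom B C} → (g ∘ f) † ≡ (f †) ∘ (g †)
    †-invol : ∀ {A B} {f : Hom A B} → (f †) † ≡ f
    𝟘 : Obj
    ! : ∀ {A} → Hom A 𝟘
    !-unique : ∀ {A} (f : Hom A 𝟘) → f ≡ !
    ¡ : ∀ {A} → Hom 𝟘 A
    ¡-unique : ∀ {A} (f : Hom 𝟘 A) → f ≡ ¡

  zero : ∀ {A B} → Hom A B
  zero = ¡ ∘ !

  IsDaggerMono : ∀ {A B} → Hom A B → Set ℓ
  IsDaggerMono m = (m †) ∘ m ≡ id

  IsKernel : ∀ {K A B} → Hom A B → Hom K A → Set (o ⊔ ℓ)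
  IsKernel {K} {A} {B} f k =
    (f ∘ k ≡ zero) ×
    (∀ {Z} (h : Hom Z A) → f ∘ h ≡ zero →
       Σ (Hom Z K) λ u → (k ∘ u ≡ h) × (∀ (u' : Hom Z K) → k ∘ u' ≡ h → u' ≡ u))

  field
    -- binary dagger biproducts (together with the zero object: finite ones)
    _⊕_ : Obj → Obj → Obj
    π₁ : ∀ {A B} → Hom (A ⊕ B) A
    π₂ : ∀ {A B} → Hom (A ⊕ B) B
    κ₁ : ∀ {A B} → Hom A (A ⊕ B)
    κ₂ : ∀ {A B} → Hom B (A ⊕ B)
    ⟨_,_⟩ : ∀ {Z A B} → Hom Z A → Hom Z B → Hom Z (A ⊕ B)
    π₁-⟨⟩ : ∀ {Z A B} {f : Hom Z A} {g : Hom Z B} → π₁ ∘ ⟨ f , g ⟩ ≡ f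
    π₂-⟨⟩ : ∀ {Z A B} {f : Hom Z A} {g : Hom Z B} → π₂ ∘ ⟨ f , g ⟩ ≡ g
    ⟨⟩-unique : ∀ {Z A B} {f : Hom Z A} {g : Hom Z B} (h : Hom Z (A ⊕ B)) →
                π₁ ∘ h ≡ f → π₂ ∘ h ≡ g → h ≡ ⟨ f , g ⟩
    [_,_] : ∀ {Z A B} → Hom A Z → Hom B Z → Hom (A ⊕ B) Z
    []-κ₁ : ∀ {Z A B} {f : Hom A Z} {g : Hom B Z} → [ f , g ] ∘ κ₁ ≡ f
    []-κ₂ : ∀ {Z A B} {f : Hom A Z} {g : Hom B Z} → [ f , g ] ∘ κ₂ ≡ g
    []-unique : ∀ {Z A B} {f : Hom A Z} {g : Hom B Z} (h : Hom (A ⊕ B) Z) →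
                h ∘ κ₁ ≡ f → h ∘ κ₂ ≡ g → h ≡ [ f , g ]
    π₁κ₁ : ∀ {A B} → π₁ ∘ κ₁ {A} {B} ≡ id
    π₂κ₂ : ∀ {A B} → π₂ ∘ κ₂ {A} {B} ≡ id
    π₁κ₂ : ∀ {A B} → π₁ ∘ κ₂ {A} {B} ≡ zero
    π₂κ₁ : ∀ {A B} → π₂ ∘ κ₁ {A} {B} ≡ zero
    π₁-† : ∀ {A B} → π₁ {A} {B} † ≡ κ₁
    π₂-† : ∀ {A B} → π₂ {A} {B} † ≡ κ₂

    Eq : ∀ {A B} → Hom A B → Hom A B → Obj
    eq : ∀ {A B} (f g : Hom A B) → Hom (Eq f g) A
    eq-equalises : ∀ {A B} (f g : Hom A B) → f ∘ eq f g ≡ g ∘ eq f g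
    eq-universal : ∀ {A B Z} (f g : Hom A B) (h : Hom Z A) → f ∘ h ≡ g ∘ h →
                   Σ (Hom Z (Eq f g)) λ u →
                     (eq f g ∘ u ≡ h) × (∀ u' → eq f g ∘ u' ≡ h → u' ≡ u)
    eq-†mono : ∀ {A B} (f g : Hom A B) → IsDaggerMono (eq f g)

    †mono-kernel : ∀ {M A} (m : Hom M A) → IsDaggerMono m →
                   Σ Obj λ B → Σ (Hom A B) λ f → IsKernel f m

    _⊗₀_ : Obj → Obj → Obj
    _⊗₁_ : ∀ {A B C D} → Hom A B → Hom C D → Hom (A ⊗₀ C) (B ⊗₀ D)
    ⊗-id : ∀ {A B} → id {A} ⊗₁ id {B} ≡ id
    ⊗-∘ : ∀ {A B C A' B' C'} {f : Hom A B} {g : Hom B C}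
            {f' : Hom A' B'} {g' : Hom B' C'} →
          (g ∘ f) ⊗₁ (g' ∘ f') ≡ (g ⊗₁ g') ∘ (f ⊗₁ f')
    I : Obj
    α : ∀ {A B C} → Hom ((A ⊗₀ B) ⊗₀ C) (A ⊗₀ (B ⊗₀ C))
    λ′ : ∀ {A} → Hom (I ⊗₀ A) A
    ρ : ∀ {A} → Hom (A ⊗₀ I) A
    σ : ∀ {A B} → Hom (A ⊗₀ B) (B ⊗₀ A)
    α-natural : ∀ {A B C A' B' C'} {f : Hom A A'} {g : Hom B B'} {h : Hom C C'} →
                α ∘ ((f ⊗₁ g) ⊗₁ h) ≡ (f ⊗₁ (g ⊗₁ h)) ∘ α
    λ-natural : ∀ {A B} {f : Hom A B} → λ′ ∘ (id ⊗₁ f) ≡ f ∘ λ′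
    ρ-natural : ∀ {A B} {f : Hom A B} → ρ ∘ (f ⊗₁ id) ≡ f ∘ ρ
    σ-natural : ∀ {A B A' B'} {f : Hom A A'} {g : Hom B B'} →
                σ ∘ (f ⊗₁ g) ≡ (g ⊗₁ f) ∘ σ
    pentagon : ∀ {A B C D} →
               α {A} {B} {C ⊗₀ D} ∘ α {A ⊗₀ B} {C} {D}
               ≡ (id ⊗₁ α) ∘ α {A} {B ⊗₀ C} {D} ∘ (α ⊗₁ id)
    triangle : ∀ {A B} → (id {A} ⊗₁ λ′ {B}) ∘ α ≡ ρ ⊗₁ id
    hexagon : ∀ {A B C} →
              α {B} {C} {A} ∘ σ {A} {B ⊗₀ C} ∘ α {A} {B} {C}
              ≡ (id ⊗₁ σ) ∘ α {B} {A} {C} ∘ (σ ⊗₁ id)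
    σ-symmetric : ∀ {A B} → σ {B} {A} ∘ σ {A} {B} ≡ id
    ⊗-† : ∀ {A B C D} {f : Hom A B} {g : Hom C D} → (f ⊗₁ g) † ≡ (f †) ⊗₁ (g †)
    α-†iso₁ : ∀ {A B C} → (α {A} {B} {C} †) ∘ α ≡ id
    α-†iso₂ : ∀ {A B C} → α {A} {B} {C} ∘ (α †) ≡ id
    λ-†iso₁ : ∀ {A} → (λ′ {A} †) ∘ λ′ ≡ id
    λ-†iso₂ : ∀ {A} → λ′ {A} ∘ (λ′ †) ≡ id
    ρ-†iso₁ : ∀ {A} → (ρ {A} †) ∘ ρ ≡ id
    ρ-†iso₂ : ∀ {A} → ρ {A} ∘ (ρ †) ≡ id
    σ-†iso₁ : ∀ {A B} → (σ {A} {B} †) ∘ σ ≡ id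
    σ-†iso₂ : ∀ {A B} → σ {A} {B} ∘ (σ †) ≡ id

  Mono : ∀ {M A} → Hom M A → Set (o ⊔ ℓ)
  Mono {M} m = ∀ {Z} (a b : Hom Z M) → m ∘ a ≡ m ∘ b → a ≡ b

  -- order on (representatives of) subobjects: m ≤ n iff m = n ∘ h for some h
  _≤ₛ_ : ∀ {M N X} → Hom M X → Hom N X → Set ℓ
  _≤ₛ_ {M} {N} m n = Σ (Hom M N) λ h → m ≡ n ∘ h

  _≈ₛ_ : ∀ {M N X} → Hom M X → Hom N X → Set ℓ
  m ≈ₛ n = (m ≤ₛ n) × (n ≤ₛ m)

  Simple : Obj → Set (o ⊔ ℓ)
  Simple C = ∀ {M} (m : Hom M C) → Mono m → (m ≈ₛ ¡ {C}) ⊎ (m ≈ₛ id {C})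

module Submission where

open import Defs
open import Level using (Level)
open import Data.Product using (Σ; _×_; _,_; proj₁)
open import Data.Sum using (_⊎_; inj₁; inj₂)
open import Data.Empty using (⊥-elim)
open import Relation.Binary.PropositionalEquality using (_≡_; sym; trans; cong; cong₂)
open import Relation.Nullary using (¬_)

-- The dagger of the equaliser of k† and 0 is a cokernel c of k, so both
-- f and g factor through c, say f = t ∘ c and g = t' ∘ c.  As k is the kernel
-- of f, t has trivial kernel, and in a category with dagger equalisers whose
-- dagger monos are kernels this makes t mono.  A mono into the simple object C
-- is either zero (then f = 0, and g = 0 too) or invertible (then g = t' t⁻¹ f).
-- Uniqueness: the equaliser of two solutions s, s' is a mono into C through
-- which f ≠ 0 factors, hence invertible, hence s = s'.

module _ {o ℓ : Level} (H : PreHilbert o ℓ) where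
  open PreHilbert H
  open Relation.Binary.PropositionalEquality.≡-Reasoning

  ¡∘≡zero : ∀ {A B} (h : Hom A 𝟘) → ¡ {B} ∘ h ≡ zero
  ¡∘≡zero h = cong (¡ ∘_) (!-unique h)

  zero-∘ : ∀ {A B C} (x : Hom A B) → zero {B} {C} ∘ x ≡ zero
  zero-∘ x = trans assoc (¡∘≡zero (! ∘ x))

  zero-† : ∀ {A B} → zero {A} {B} † ≡ zero
  zero-† = trans †-∘ (cong₂ _∘_ (¡-unique (! †)) (!-unique (¡ †)))

  †-injective : ∀ {A B} {a b : Hom A B} → a † ≡ b † → a ≡ b
  †-injective p = trans (sym †-invol) (trans (cong _† p) †-invol)

  †≡zero : ∀ {A B} {a : Hom A B} → a † ≡ zero → a ≡ zero
  †≡zero p = †-injective (trans p (sym zero-†))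

  †-annihilates : ∀ {A B C} {a : Hom B C} {b : Hom A B} →
                  a ∘ b ≡ zero → b † ∘ a † ≡ zero
  †-annihilates p = trans (sym †-∘) (trans (cong _† p) zero-†)

  retract-∘ : ∀ {A B Z} {r : Hom B A} {m : Hom A B} (x : Hom Z A) →
              r ∘ m ≡ id → r ∘ (m ∘ x) ≡ x
  retract-∘ x rm = trans (sym assoc) (trans (cong (_∘ x) rm) identityˡ)

  split-mono-cancel : ∀ {A B Z} {r : Hom B A} {m : Hom A B} {a b : Hom Z A} →
                      r ∘ m ≡ id → m ∘ a ≡ m ∘ b → a ≡ b
  split-mono-cancel {r = r} {a = a} {b} rm p = begin
    a             ≡⟨ sym (retract-∘ a rm) ⟩
    r ∘ (_ ∘ a)   ≡⟨ cong (r ∘_) p ⟩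
    r ∘ (_ ∘ b)   ≡⟨ retract-∘ b rm ⟩
    b             ∎

  split-epi-cancel : ∀ {A B Z} {m : Hom A B} {v : Hom B A} {a b : Hom B Z} →
                     m ∘ v ≡ id → a ∘ m ≡ b ∘ m → a ≡ b
  split-epi-cancel {v = v} {a} {b} mv p = begin
    a             ≡⟨ sym identityʳ ⟩
    a ∘ id        ≡⟨ cong (a ∘_) (sym mv) ⟩
    a ∘ (_ ∘ v)   ≡⟨ sym assoc ⟩
    (a ∘ _) ∘ v   ≡⟨ cong (_∘ v) p ⟩
    (b ∘ _) ∘ v   ≡⟨ assoc ⟩
    b ∘ (_ ∘ v)   ≡⟨ cong (b ∘_) mv ⟩
    b ∘ id        ≡⟨ identityʳ ⟩
    b             ∎

  †mono⇒mono : ∀ {A B} (m : Hom A B) → IsDaggerMono m → Mono m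
  †mono⇒mono _ m†m≡id _ _ = split-mono-cancel m†m≡id

  kernel-of-zero-section : ∀ {K A B} {f : Hom A B} {k : Hom K A} →
                           IsKernel f k → f ≡ zero → Σ (Hom A K) λ u → k ∘ u ≡ id
  kernel-of-zero-section (_ , universal) f≡zero
    with universal id (trans identityʳ f≡zero)
  ... | u , ku , _ = u , ku

  kernel-annihilates-smaller : ∀ {K L A B} {g : Hom A B} {k : Hom K A} {l : Hom L A} →
                               IsKernel g l → k ≤ₛ l → g ∘ k ≡ zero
  kernel-annihilates-smaller {g = g} {k} {l} (gl , _) (h , k≡lh) = begin
    g ∘ k         ≡⟨ cong (g ∘_) k≡lh ⟩
    g ∘ (l ∘ h)   ≡⟨ sym assoc ⟩
    (g ∘ l) ∘ h   ≡⟨ cong (_∘ h) gl ⟩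
    zero ∘ h      ≡⟨ zero-∘ h ⟩
    zero          ∎

  -- t† factors through the equaliser m of a† and b†; its kernel h kills t†, so
  -- h† is killed by t and h = 0, whence m is split epi and a† = b†.
  trivial-kernel⇒mono : ∀ {W C} (t : Hom W C) →
                        (∀ {Z} (h : Hom Z W) → t ∘ h ≡ zero → h ≡ zero) → Mono t
  trivial-kernel⇒mono t trivial a b ta≡tb
    with eq-universal (a †) (b †) (t †) (trans (sym †-∘) (trans (cong _† ta≡tb) †-∘))
       | †mono-kernel (eq (a †) (b †)) (eq-†mono (a †) (b †))
  ... | u , mu≡t† , _ | _ , h , kernel-of-h = †-injective a†≡b†
    where
      m = eq (a †) (b †)

      h∘t†≡zero : h ∘ t † ≡ zero
      h∘t†≡zero = begin
        h ∘ t †        ≡⟨ cong (h ∘_) (sym mu≡t†) ⟩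
        h ∘ (m ∘ u)    ≡⟨ sym assoc ⟩
        (h ∘ m) ∘ u    ≡⟨ cong (_∘ u) (proj₁ kernel-of-h) ⟩
        zero ∘ u       ≡⟨ zero-∘ u ⟩
        zero           ∎

      h≡zero : h ≡ zero
      h≡zero = †≡zero (trivial (h †)
                 (trans (cong (_∘ h †) (sym †-invol)) (†-annihilates h∘t†≡zero)))

      a†≡b† : a † ≡ b †
      a†≡b† with kernel-of-zero-section kernel-of-h h≡zero
      ... | v , mv = split-epi-cancel mv (eq-equalises (a †) (b †))

  cokernel : ∀ {K A} (k : Hom K A) → Hom A (Eq (k †) zero)
  cokernel k = eq (k †) zero †

  cokernel-∘-kernel : ∀ {K A} (k : Hom K A) → cokernel k ∘ k ≡ zero
  cokernel-∘-kernel k = †≡zero (begin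
    (cokernel k ∘ k) †          ≡⟨ †-∘ ⟩
    k † ∘ cokernel k †          ≡⟨ cong (k † ∘_) †-invol ⟩
    k † ∘ eq (k †) zero         ≡⟨ eq-equalises (k †) zero ⟩
    zero ∘ eq (k †) zero        ≡⟨ zero-∘ _ ⟩
    zero                        ∎)

  cokernel-†epi : ∀ {K A} (k : Hom K A) → cokernel k ∘ cokernel k † ≡ id
  cokernel-†epi k = trans (cong (cokernel k ∘_) †-invol) (eq-†mono (k †) zero)

  cokernel-factor : ∀ {K A B} {k : Hom K A} (x : Hom A B) → x ∘ k ≡ zero →
                    Σ (Hom (Eq (k †) zero) B) λ t → x ≡ t ∘ cokernel k
  cokernel-factor {k = k} x xk≡zero
    with eq-universal (k †) zero (x †) (trans (†-annihilates xk≡zero) (sym (zero-∘ _)))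
  ... | u , eu≡x† , _ =
    u † , trans (sym †-invol) (trans (cong _† (sym eu≡x†)) †-∘)

  -- If t ∘ h = 0, then cokernel k † ∘ h lies in the kernel k of f, so
  -- h = cokernel k ∘ (cokernel k † ∘ h) factors through cokernel k ∘ k = 0.
  cokernel-of-kernel-induces-mono : ∀ {K A B} {f : Hom A B} {k : Hom K A}
                                    {t : Hom (Eq (k †) zero) B} →
                                    IsKernel f k → f ≡ t ∘ cokernel k → Mono t
  cokernel-of-kernel-induces-mono {f = f} {k} {t} (_ , universal) f≡tc =
    trivial-kernel⇒mono t trivial-kernel
    where
      c = cokernel k

      trivial-kernel : ∀ {Z} (h : Hom Z (Eq (k †) zero)) → t ∘ h ≡ zero → h ≡ zero
      trivial-kernel h th≡zero with universal (c † ∘ h) (begin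
        f ∘ (c † ∘ h)         ≡⟨ cong (_∘ (c † ∘ h)) f≡tc ⟩
        (t ∘ c) ∘ (c † ∘ h)   ≡⟨ assoc ⟩
        t ∘ (c ∘ (c † ∘ h))   ≡⟨ cong (t ∘_) (retract-∘ h (cokernel-†epi k)) ⟩
        t ∘ h                 ≡⟨ th≡zero ⟩
        zero                  ∎)
      ... | y , ky≡c†h , _ = begin
        h                     ≡⟨ sym (retract-∘ h (cokernel-†epi k)) ⟩
        c ∘ (c † ∘ h)         ≡⟨ cong (c ∘_) (sym ky≡c†h) ⟩
        c ∘ (k ∘ y)           ≡⟨ sym assoc ⟩
        (c ∘ k) ∘ y           ≡⟨ cong (_∘ y) (cokernel-∘-kernel k) ⟩
        zero ∘ y              ≡⟨ zero-∘ y ⟩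
        zero                  ∎

  mono-into-simple : ∀ {W C} {t : Hom W C} → Simple C → Mono t →
                     (t ≡ zero) ⊎ Σ (Hom C W) λ r → (r ∘ t ≡ id) × (t ∘ r ≡ id)
  mono-into-simple {t = t} simple t-mono with simple t t-mono
  ... | inj₁ ((h , t≡¡h) , _) = inj₁ (trans t≡¡h (¡∘≡zero h))
  ... | inj₂ (_ , (r , id≡tr)) = inj₂ (r , rt≡id , sym id≡tr)
    where
      rt≡id : r ∘ t ≡ id
      rt≡id = t-mono (r ∘ t) id (begin
        t ∘ (r ∘ t)   ≡⟨ sym assoc ⟩
        (t ∘ r) ∘ t   ≡⟨ cong (_∘ t) (sym id≡tr) ⟩
        id ∘ t        ≡⟨ identityˡ ⟩
        t             ≡⟨ sym identityʳ ⟩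
        t ∘ id        ∎)

  factor-through-simple : ∀ {K X C} {f g : Hom X C} {k : Hom K X} → Simple C →
                          IsKernel f k → g ∘ k ≡ zero → Σ (Hom C C) λ s → g ≡ s ∘ f
  factor-through-simple {f = f} {g} {k} simple kernel-f gk≡zero =
    from-factorisations (cokernel-factor f (proj₁ kernel-f)) (cokernel-factor g gk≡zero)
    where
      E = Eq (k †) zero

      from-factorisations : Σ (Hom E _) (λ t → f ≡ t ∘ cokernel k) →
                            Σ (Hom E _) (λ t′ → g ≡ t′ ∘ cokernel k) →
                            Σ (Hom _ _) λ s → g ≡ s ∘ f
      from-factorisations (t , f≡tc) (t′ , g≡t′c) =
        by-cases (mono-into-simple simple (cokernel-of-kernel-induces-mono kernel-f f≡tc))
        where
          by-cases : (t ≡ zero) ⊎ Σ (Hom _ E) (λ r → (r ∘ t ≡ id) × (t ∘ r ≡ id)) →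
                     Σ (Hom _ _) λ s → g ≡ s ∘ f
          by-cases (inj₁ t≡zero) = zero , trans g≡zero (sym (zero-∘ f))
            where
              f≡zero : f ≡ zero
              f≡zero = trans f≡tc (trans (cong (_∘ cokernel k) t≡zero) (zero-∘ _))

              g≡zero : g ≡ zero
              g≡zero with kernel-of-zero-section kernel-f f≡zero
              ... | _ , ku≡id = split-epi-cancel ku≡id (trans gk≡zero (sym (zero-∘ k)))
          by-cases (inj₂ (r , rt≡id , _)) = t′ ∘ r , (begin
            g                             ≡⟨ g≡t′c ⟩
            t′ ∘ cokernel k               ≡⟨ cong (t′ ∘_) (sym (retract-∘ (cokernel k) rt≡id)) ⟩
            t′ ∘ (r ∘ (t ∘ cokernel k))   ≡⟨ sym assoc ⟩
            (t′ ∘ r) ∘ (t ∘ cokernel k)   ≡⟨ cong ((t′ ∘ r) ∘_) (sym f≡tc) ⟩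
            (t′ ∘ r) ∘ f                  ∎)

  nonzero-into-simple⇒epi : ∀ {X C D} {f : Hom X C} {s s′ : Hom C D} → Simple C →
                            ¬ (f ≡ zero) → s ∘ f ≡ s′ ∘ f → s ≡ s′
  nonzero-into-simple⇒epi {f = f} {s} {s′} simple f≢zero sf≡s′f
    with eq-universal s s′ f sf≡s′f
  ... | u , eu≡f , _
    with mono-into-simple simple (†mono⇒mono (eq s s′) (eq-†mono s s′))
  ... | inj₁ e≡zero =
    ⊥-elim (f≢zero (trans (sym eu≡f) (trans (cong (_∘ u) e≡zero) (zero-∘ u))))
  ... | inj₂ (_ , _ , er≡id) = split-epi-cancel er≡id (eq-equalises s s′)

lemma10 : ∀ {o ℓ : Level} (H : PreHilbert o ℓ) →
    let open PreHilbert H in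
    ∀ {X C K L : Obj} (f g : Hom X C) (k : Hom K X) (l : Hom L X) →
    Simple C → IsKernel f k → IsKernel g l → k ≤ₛ l →
    Σ (Hom C C) (λ s → g ≡ s ∘ f)
    × (¬ (f ≡ zero) → ∀ (s s' : Hom C C) → g ≡ s ∘ f → g ≡ s' ∘ f → s ≡ s')
lemma10 H f g k l simple kernel-f kernel-g k≤l =
  factor-through-simple H simple kernel-f (kernel-annihilates-smaller H kernel-g k≤l) ,
  λ f≢zero s s′ g≡sf g≡s′f →
    nonzero-into-simple⇒epi H simple f≢zero (trans (sym g≡sf) g≡s′f)
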